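{- The number of connected components is stable under 2-switch: for every graph $G$ and every 2-switch $\tau$, $|\kappa(\tau(G))-\kappa(G)|\le 1$.
   Context: Graphs are finite, simple, undirected and labeled. $\kappa(G)$ denotes the number of connected components of $G$. For vertices $a,b,c,d$, the 2-switch $\tau=\binom{a\ b}{c\ d}$ maps $G$ to $G-ab-cd+ac+bd$ if $ab,cd\in E(G)$, $\{a,b\}\cap\{c,d\}=\varnothing$ and $ac,bd\notin E(G)$, and to $G$ otherwise. -}

module Defs where

open import Data.Nat using (ℕ)
open import Data.Fin using (Fin; _≟_)
open import Data.Bool using (Bool; true; false; _∧_; _∨_; not; if_then_else_)
open import Data.Product using (_×_; ∃)
open import Relation.Nullary.Decidable using (⌊_⌋)
open import Relation.Binary.PropositionalEquality using (_≡_)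
open import Relation.Binary.Construct.Closure.ReflexiveTransitive using (Star)
open import Function.Bundles using (_⇔_)

Adj : ℕ → Set
Adj n = Fin n → Fin n → Bool

record IsSimpleGraph {n : ℕ} (G : Adj n) : Set where
  field
    symmetric : ∀ u v → G u v ≡ G v u
    loopless  : ∀ v → G v v ≡ false

Edge : {n : ℕ} → Adj n → Fin n → Fin n → Set
Edge G u v = G u v ≡ true

Connected : {n : ℕ} → Adj n → Fin n → Fin n → Set
Connected G = Star (Edge G)

-- κ(G) = k : the vertices are partitioned by a surjection onto Fin k
-- whose fibres are exactly the connected components.
HasComponents : {n : ℕ} → Adj n → ℕ → Set
HasComponents {n} G k =
  ∃ λ (f : Fin n → Fin k) →
    (∀ (i : Fin k) → ∃ λ v → f v ≡ i) ×
    (∀ u v → (f u ≡ f v) ⇔ Connected G u v)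

_==_ : {n : ℕ} → Fin n → Fin n → Bool
u == v = ⌊ u ≟ v ⌋

samePair : {n : ℕ} → Fin n → Fin n → Fin n → Fin n → Bool
samePair x y p q = (x == p ∧ y == q) ∨ (x == q ∧ y == p)

switchable : {n : ℕ} → Adj n → Fin n → Fin n → Fin n → Fin n → Bool
switchable G a b c d =
  G a b ∧ G c d ∧
  not (a == c) ∧ not (a == d) ∧ not (b == c) ∧ not (b == d) ∧
  not (G a c) ∧ not (G b d)

twoSwitch : {n : ℕ} → Fin n → Fin n → Fin n → Fin n → Adj n → Adj n
twoSwitch a b c d G x y =
  if switchable G a b c d
  then (if samePair x y a b ∨ samePair x y c d then false
        else if samePair x y a c ∨ samePair x y b d then true
        else G x y)
  else G x y

-- A 2-switch only changes edges at a, b, c, d, and in τG the vertex c is adjacent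
-- to a and d to b. Hence every walk of G either survives in τG or, at its first
-- changed edge, has already reached the τG-component of a or of b. Labelling each
-- τG-component by the G-component of its vertices, with one fresh label for the
-- component of a, is then injective, so κ(τG) ≤ κ(G) + 1. Exchanging the roles of
-- G and τG (now with roots a and c, as ab, cd ∈ E(G)) gives κ(G) ≤ κ(τG) + 1.
module Submission where

open import Defs
open import Data.Nat using (ℕ; zero; suc; _≤_; s≤s; ∣_-_∣)
open import Data.Fin using (Fin; _≟_) renaming (zero to fzero; suc to fsuc)
open import Data.Fin.Properties using (injective⇒≤; suc-injective)
open import Data.Bool using (true; false)
open import Data.List using (List; []; _∷_)
open import Data.List.Membership.Propositional using (_∉_)
open import Data.List.Relation.Unary.All using (All; []; _∷_; lookup)
open import Data.List.Relation.Unary.Any using (here; there; any?)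
open import Data.Product using (_×_; _,_; proj₁; proj₂)
open import Data.Sum using (_⊎_; inj₁; inj₂; map)
open import Function using (_∘_)
open import Function.Bundles using (Equivalence)
open import Relation.Nullary using (yes; no; contradiction)
open import Relation.Nullary.Decidable using (isYes≗does; dec-false; dec-true)
open import Relation.Binary.PropositionalEquality using (_≡_; _≢_; refl; sym; trans; module ≡-Reasoning)
open import Relation.Binary.Construct.Closure.ReflexiveTransitive using (ε; _◅_)

private
  variable
    n k k′ : ℕ
    G H : Adj n
    r s u v : Fin n
    ts : List (Fin n)

∣m-n∣≤1 : ∀ {m n} → m ≤ suc n → n ≤ suc m → ∣ m - n ∣ ≤ 1
∣m-n∣≤1 {zero}  {_}     _         n≤1       = n≤1
∣m-n∣≤1 {suc m} {zero}  m≤1       _         = m≤1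
∣m-n∣≤1 {suc m} {suc n} (s≤s m≤n) (s≤s n≤m) = ∣m-n∣≤1 m≤n n≤m

==-refl : (u : Fin n) → (u == u) ≡ true
==-refl u = trans (isYes≗does (u ≟ u)) (dec-true (u ≟ u) refl)

==-false : u ≢ v → (u == v) ≡ false
==-false {u = u} {v} u≢v = trans (isYes≗does (u ≟ v)) (dec-false (u ≟ v) u≢v)

edge⇒≢ : IsSimpleGraph G → Edge G u v → u ≢ v
edge⇒≢ simple e refl with () ← trans (sym e) (IsSimpleGraph.loopless simple _)

≤-of-connected-fibres : ∀ {n k m} {H : Adj n} → HasComponents H k →
                        (g : Fin n → Fin m) → (∀ u v → g u ≡ g v → Connected H u v) → k ≤ m
≤-of-connected-fibres {n} {k} (f , surj , f-conn) g g-conn = injective⇒≤ g∘rep-injective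
  where
  open ≡-Reasoning

  rep : Fin k → Fin n
  rep i = proj₁ (surj i)

  g∘rep-injective : ∀ {i j} → g (rep i) ≡ g (rep j) → i ≡ j
  g∘rep-injective {i} {j} e = begin
    i         ≡⟨ proj₂ (surj i) ⟨
    f (rep i) ≡⟨ Equivalence.from (f-conn _ _) (g-conn _ _ e) ⟩
    f (rep j) ≡⟨ proj₂ (surj j) ⟩
    j         ∎

NearRoots : Adj n → Fin n → Fin n → Fin n → Set
NearRoots H r s x = Connected H x r ⊎ Connected H x s

AgreeOff : List (Fin n) → Adj n → Adj n → Set
AgreeOff ts G H = ∀ x y → x ∉ ts → G x y ≡ H x y

reroute : AgreeOff ts G H → All (NearRoots H r s) ts →
          Connected G u v → Connected H u v ⊎ NearRoots H r s u
reroute agree near ε = inj₁ ε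
reroute {ts = ts} {H = H} agree near (_◅_ {i = u} {j = w} e p) with any? (u ≟_) ts
... | yes u∈ts = inj₂ (lookup near u∈ts)
... | no  u∉ts = map (e′ ◅_) (map (e′ ◅_) (e′ ◅_)) (reroute agree near p)
  where
  e′ : Edge H u w
  e′ = trans (sym (agree u w u∉ts)) e

-- Only the component of r needs a fresh label: if a G-walk from u to v reroutes
-- u to s, then the reverse walk reroutes v to u or to s.
components-≤-suc : {G H : Adj n} {r s : Fin n} →
                   HasComponents G k → HasComponents H k′ →
                   AgreeOff ts G H → All (NearRoots H r s) ts → k′ ≤ suc k
components-≤-suc {n} {k} {H = H} {r} {s}
                 (f , _ , f-conn) hc′@(f′ , _ , f′-conn) agree near =
  ≤-of-connected-fibres hc′ g g-conn
  where
  toH : f′ u ≡ f′ v → Connected H u v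
  toH = Equivalence.to (f′-conn _ _)

  fromH : Connected H u v → f′ u ≡ f′ v
  fromH = Equivalence.from (f′-conn _ _)

  route : f u ≡ f v → f′ u ≡ f′ v ⊎ f′ u ≡ f′ r ⊎ f′ u ≡ f′ s
  route fu≡fv = map fromH (map fromH fromH) (reroute agree near (Equivalence.to (f-conn _ _) fu≡fv))

  merge : f′ u ≢ f′ r → f′ v ≢ f′ r → f u ≡ f v → f′ u ≡ f′ v
  merge u≁r v≁r fu≡fv with route fu≡fv | route (sym fu≡fv)
  ... | inj₁ u~v        | _               = u~v
  ... | inj₂ (inj₁ u~r) | _               = contradiction u~r u≁r
  ... | _               | inj₁ v~u        = sym v~u
  ... | _               | inj₂ (inj₁ v~r) = contradiction v~r v≁r
  ... | inj₂ (inj₂ u~s) | inj₂ (inj₂ v~s) = trans u~s (sym v~s)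

  g : Fin n → Fin (suc k)
  g u with f′ u ≟ f′ r
  ... | yes _ = fzero
  ... | no  _ = fsuc (f u)

  g-conn : ∀ u v → g u ≡ g v → Connected H u v
  g-conn u v with f′ u ≟ f′ r | f′ v ≟ f′ r
  ... | yes u~r | yes v~r = λ _ → toH (trans u~r (sym v~r))
  ... | yes _   | no  _   = λ ()
  ... | no  _   | yes _   = λ ()
  ... | no  u≁r | no  v≁r = toH ∘ merge u≁r v≁r ∘ suc-injective

module TwoSwitch {n : ℕ} (G : Adj n) (a b c d : Fin n) where

  τG : Adj n
  τG = twoSwitch a b c d G

  unswitchable⇒≡ : switchable G a b c d ≡ false → ∀ x y → τG x y ≡ G x y
  unswitchable⇒≡ sw x y rewrite sw = refl

  agreeOff-abcd : AgreeOff (a ∷ b ∷ c ∷ d ∷ []) G τG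
  agreeOff-abcd x y x∉ with switchable G a b c d
  ... | false = refl
  ... | true
    rewrite ==-false (x∉ ∘ here) | ==-false (x∉ ∘ there ∘ here)
          | ==-false (x∉ ∘ there ∘ there ∘ here) | ==-false (x∉ ∘ there ∘ there ∘ there ∘ here)
    = refl

  switchable⇒ : switchable G a b c d ≡ true →
                Edge G a b × Edge G c d × a ≢ c × a ≢ d × b ≢ c × b ≢ d
  switchable⇒ sw with G a b | G c d | a ≟ c | a ≟ d | b ≟ c | b ≟ d
  ... | true | true | no a≢c | no a≢d | no b≢c | no b≢d = refl , refl , a≢c , a≢d , b≢c , b≢d

  module _ (simple : IsSimpleGraph G) (sw : switchable G a b c d ≡ true) where

    adds-ca : Edge τG c a
    adds-ca with _ , cd , a≢c , a≢d , b≢c , _ ← switchable⇒ sw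
      rewrite sw | ==-false (a≢c ∘ sym) | ==-false (b≢c ∘ sym) | ==-false a≢d | ==-false a≢c
            | ==-false (edge⇒≢ simple cd) | ==-refl a | ==-refl c
      = refl

    adds-db : Edge τG d b
    adds-db with _ , cd , _ , a≢d , b≢c , b≢d ← switchable⇒ sw
      rewrite sw | ==-false (a≢d ∘ sym) | ==-false (b≢d ∘ sym) | ==-false (edge⇒≢ simple cd ∘ sym)
            | ==-false b≢c | ==-refl b | ==-refl d
      = refl

  module _ (simple : IsSimpleGraph G) {k k′ : ℕ}
           (hc : HasComponents G k) (hc′ : HasComponents τG k′) where

    open IsSimpleGraph simple

    splits-at-most-one : k′ ≤ suc k
    splits-at-most-one = by-cases _ refl
      where
      by-cases : ∀ t → switchable G a b c d ≡ t → k′ ≤ suc k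
      by-cases false sw = components-≤-suc {r = a} {s = a} hc hc′
                            (λ x y _ → sym (unswitchable⇒≡ sw x y)) []
      by-cases true  sw = components-≤-suc {r = a} {s = b} hc hc′ agreeOff-abcd
                            (inj₁ ε ∷ inj₂ ε ∷ inj₁ (adds-ca simple sw ◅ ε)
                                             ∷ inj₂ (adds-db simple sw ◅ ε) ∷ [])

    merges-at-most-one : k ≤ suc k′
    merges-at-most-one = by-cases _ refl
      where
      by-cases : ∀ t → switchable G a b c d ≡ t → k ≤ suc k′
      by-cases false sw = components-≤-suc {r = a} {s = a} hc′ hc
                            (λ x y _ → unswitchable⇒≡ sw x y) []
      by-cases true  sw with ab , cd , _ ← switchable⇒ sw =
        components-≤-suc {r = a} {s = c} hc′ hc (λ x y x∉ → sym (agreeOff-abcd x y x∉))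
          (inj₁ ε ∷ inj₁ (trans (symmetric b a) ab ◅ ε)
                  ∷ inj₂ ε ∷ inj₂ (trans (symmetric d c) cd ◅ ε) ∷ [])

theorem11 : ∀ (n : ℕ) (G : Adj n) → IsSimpleGraph G →
              ∀ (a b c d : Fin n) (k k′ : ℕ) →
              HasComponents G k → HasComponents (twoSwitch a b c d G) k′ →
              ∣ k′ - k ∣ ≤ 1
theorem11 n G simple a b c d k k′ hc hc′ =
  ∣m-n∣≤1 (splits-at-most-one simple hc hc′) (merges-at-most-one simple hc hc′)
  where open TwoSwitch G a b c d
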